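{- Let $\mathcal{C}$ be a relational structure with finite carrier $C$, $\Sigma$ a finite set of constructors with variances, and let $u^S$ be a shape variable. There exists an algorithm that, given a conjunction $\psi\equiv\bigwedge_{i=1}^n\psi_i$ where each $\psi_i$ has the form $|\phi_i|_{u^S}=k_i$ or $|\phi_i|_{u^S}\ge k_i$ for some closed first-order $L_C$-formula $\phi_i$ and integer $k_i\ge0$, finitely computes the set $A=\{s \mid \psi \text{ holds when } u^S \text{ is interpreted as } s\}$ of shapes satisfying $\psi$.
   Context: $\mathcal{C}$ is a relational structure in a relational language $L_C$ containing a distinguished binary symbol $\le$; $\mathcal{C}^{ -1}$ denotes the same structure with $\le$ interpreted as the inverse relation. $\Sigma$ is a finite set of constructor symbols, each of arity $\ge 1$, each with variances $v(f,i)\in\{ -1,1\}$ for $1\le i\le\mathrm{ar}(f)$. Shapes are the finite ground terms over $\{c^S\}\cup\{f^S: f\in\Sigma\}$, where $c^S$ is a constant and $f^S$ has the arity of $f$. A leaf of a shape $s$ is an occurrence of $c^S$ in $s$, identified with the sequence $\langle f^1,i^1\rangle\cdots\langle f^n,i^n\rangle$ of (constructor, argument index) pairs on the path from the root to it; its variance is $\prod_{j=1}^n v(f^j,i^j)$. For a closed $L_C$-formula $\phi$ and shape $s$, $|\phi|_s$ is the number of leaves $l$ of $s$ such that $\phi$ is true in $\mathcal{C}$ if $l$ has variance $1$, and true in $\mathcal{C}^{ -1}$ if $l$ has variance $-1$. An algorithm finitely computes a set-valued function $F$ (with values subsets of an infinite set) if on each input it outputs the finite set $F(a)$ when $F(a)$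 is finite, and outputs a special symbol $\infty$ when $F(a)$ is infinite. -}

module Defs where

open import Data.Nat using (ℕ; zero; suc; _≤_)
open import Data.Bool using (Bool; true; false; T)
open import Data.Fin using (Fin; zero; suc; _≟_)
open import Data.Fin.Properties using (all?; any?)
open import Data.Vec using (Vec; []; _∷_; map)
open import Data.List using (List; []; _∷_; _++_; length; filter; foldr)
import Data.List as List
open import Data.List.Membership.Propositional using (_∈_)
open import Data.List.Relation.Unary.All using (All)
open import Data.Sign using (Sign; +; -; _*_)
open import Data.Product using (Σ; _,_; _×_)
open import Data.Sum using (_⊎_)
open import Data.Unit using (⊤)
open import Data.Empty using (⊥)
open import Function using (id; _∘_)
open import Function.Bundles using (_⇔_)
open import Relation.Nullary using (¬_; Dec; yes; no; does)
open import Relation.Nullary.Decidable using (_×-dec_; _⊎-dec_; _→-dec_; ¬?)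
open import Relation.Binary.PropositionalEquality using (_≡_)

-- Relational languages L_C with a distinguished binary symbol ≤.
-- The remaining relation symbols are given by an arbitrary type with arities.

record Lang : Set₁ where
  field
    Other : Set
    arity : Other → ℕ
open Lang public

record Structure (L : Lang) : Set where
  field
    size  : ℕ
    leqI  : Fin size → Fin size → Bool
    relI  : (o : Other L) → Vec (Fin size) (arity L o) → Bool
open Structure public

inverse : ∀ {L} → Structure L → Structure L
inverse M = record { size = size M ; leqI = λ x y → leqI M y x ; relI = relI M }

-- First-order L-formulas (with equality) with free variables among Fin n
-- (de Bruijn style: ∀ and ∃ bind variable zero).
data Formula (L : Lang) : ℕ → Set where
  leq   : ∀ {n} → Fin n → Fin n → Formula L n
  rel   : ∀ {n} (o : Other L) → Vec (Fin n) (arity L o) → Formula L n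
  equal : ∀ {n} → Fin n → Fin n → Formula L n
  true′ false′ : ∀ {n} → Formula L n
  not   : ∀ {n} → Formula L n → Formula L n
  and or imp : ∀ {n} → Formula L n → Formula L n → Formula L n
  all ex : ∀ {n} → Formula L (suc n) → Formula L n

Sentence : Lang → Set
Sentence L = Formula L zero

extend : ∀ {A : Set} {n} → A → (Fin n → A) → Fin (suc n) → A
extend a ρ zero = a
extend a ρ (suc i) = ρ i

Sat : ∀ {L n} (M : Structure L) → Formula L n → (Fin n → Fin (size M)) → Set
Sat M (leq x y)   ρ = T (leqI M (ρ x) (ρ y))
Sat M (rel o xs)  ρ = T (relI M o (map ρ xs))
Sat M (equal x y) ρ = ρ x ≡ ρ y
Sat M true′       ρ = ⊤
Sat M false′      ρ = ⊥
Sat M (not φ)     ρ = ¬ Sat M φ ρ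
Sat M (and φ ψ)   ρ = Sat M φ ρ × Sat M ψ ρ
Sat M (or φ ψ)    ρ = Sat M φ ρ ⊎ Sat M ψ ρ
Sat M (imp φ ψ)   ρ = Sat M φ ρ → Sat M ψ ρ
Sat M (all φ)     ρ = ∀ a → Sat M φ (extend a ρ)
Sat M (ex φ)      ρ = Σ (Fin (size M)) λ a → Sat M φ (extend a ρ)

noVars : ∀ {A : Set} → Fin zero → A
noVars ()

_⊨_ : ∀ {L} → Structure L → Sentence L → Set
M ⊨ φ = Sat M φ noVars

T? : (b : Bool) → Dec (T b)
T? true = yes Data.Unit.tt
T? false = no (λ ())

sat? : ∀ {L n} (M : Structure L) (φ : Formula L n) (ρ : Fin n → Fin (size M)) → Dec (Sat M φ ρ)
sat? M (leq x y)   ρ = T? (leqI M (ρ x) (ρ y))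
sat? M (rel o xs)  ρ = T? (relI M o (map ρ xs))
sat? M (equal x y) ρ = ρ x ≟ ρ y
sat? M true′       ρ = yes Data.Unit.tt
sat? M false′      ρ = no (λ ())
sat? M (not φ)     ρ = ¬? (sat? M φ ρ)
sat? M (and φ ψ)   ρ = sat? M φ ρ ×-dec sat? M ψ ρ
sat? M (or φ ψ)    ρ = sat? M φ ρ ⊎-dec sat? M ψ ρ
sat? M (imp φ ψ)   ρ = sat? M φ ρ →-dec sat? M ψ ρ
sat? M (all φ)     ρ = all? (λ a → sat? M φ (extend a ρ))
sat? M (ex φ)      ρ = any? (λ a → sat? M φ (extend a ρ))

record Signature : Set where
  field
    count    : ℕ
    ar       : Fin count → ℕ
    ar-pos   : ∀ f → 1 ≤ ar f
    variance : (f : Fin count) → Fin (ar f) → Sign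
open Signature public

data Shape (Sg : Signature) : Set where
  cS : Shape Sg
  fS : (f : Fin (count Sg)) → Vec (Shape Sg) (ar Sg f) → Shape Sg

-- A leaf is identified with the path of (constructor, argument index) pairs.
Step : Signature → Set
Step Sg = Σ (Fin (count Sg)) λ f → Fin (ar Sg f)

Path : Signature → Set
Path Sg = List (Step Sg)

mutual
  leaves : ∀ {Sg} → Shape Sg → List (Path Sg)
  leaves cS = [] ∷ []
  leaves (fS f ss) = leavesV f ss id

  leavesV : ∀ {Sg} (f : Fin (count Sg)) {n} → Vec (Shape Sg) n → (Fin n → Fin (ar Sg f)) → List (Path Sg)
  leavesV f [] ι = []
  leavesV f (s ∷ ss) ι = List.map ((f , ι zero) ∷_) (leaves s) ++ leavesV f ss (ι ∘ suc)

leafVariance : ∀ {Sg} → Path Sg → Sign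
leafVariance {Sg} [] = +
leafVariance {Sg} ((f , i) ∷ p) = variance Sg f i * leafVariance {Sg} p

HoldsAt : ∀ {L} → Structure L → Sentence L → Sign → Set
HoldsAt C φ + = C ⊨ φ
HoldsAt C φ - = inverse C ⊨ φ

holdsAt? : ∀ {L} (C : Structure L) (φ : Sentence L) (σ : Sign) → Dec (HoldsAt C φ σ)
holdsAt? C φ + = sat? C φ noVars
holdsAt? C φ - = sat? (inverse C) φ noVars

∣_∣[_]_ : ∀ {L Sg} → Sentence L → Structure L → Shape Sg → ℕ
∣_∣[_]_ {Sg = Sg} φ C s = length (filter (λ l → holdsAt? C φ (leafVariance {Sg} l)) (leaves s))

data Constraint (L : Lang) : Set where
  exactly : Sentence L → ℕ → Constraint L
  atLeast : Sentence L → ℕ → Constraint L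

HoldsC : ∀ {L Sg} → Structure L → Constraint L → Shape Sg → Set
HoldsC C (exactly φ k) s = ∣ φ ∣[ C ] s ≡ k
HoldsC C (atLeast φ k) s = k ≤ ∣ φ ∣[ C ] s

HoldsConj : ∀ {L Sg} → Structure L → List (Constraint L) → Shape Sg → Set
HoldsConj C ψ s = All (λ c → HoldsC C c s) ψ

-- Finite computation of a set of shapes: the output is either a finite
-- list enumerating exactly the set, or the symbol ∞ together with
-- evidence that the set is infinite (not contained in any finite list).

FinitelyComputed : ∀ {Sg} → (Shape Sg → Set) → Set
FinitelyComputed {Sg} A =
  (Σ (List (Shape Sg)) λ xs → ∀ s → A s ⇔ s ∈ xs)
  ⊎ ¬ (Σ (List (Shape Sg)) λ xs → ∀ s → A s → s ∈ xs)

-- Whether a shape satisfies ψ depends only on its numbers of leaves of variance +1 and -1,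
-- capped at K = 1 + max kᵢ.  These capped counts (the sign type) form a compositional
-- invariant with T = (K+1)² values, so by pigeonhole along a longest path every shape of
-- height ≥ T contains a loop that can be pumped to any height, or cut out, without changing
-- its sign type.  Hence the solution set is infinite iff it has a member of height ≥ T, and
-- otherwise consists of the solutions of height < T.  A tall solution, if any, can be found
-- among the shapes of height < T(T+1): cutting loops with respect to the finer invariant
-- (sign type, height capped at T) keeps a tall solution tall.

module Submission where

open import Defs
open import Data.Bool using (true; false; if_then_else_)
open import Data.Fin as Fin using (Fin; zero; suc; toℕ; fromℕ<; combine)
import Data.Fin.Properties as Finₚ
open import Data.List as List using (List; []; _∷_; _++_; length; filter; take; drop)
import Data.List.Properties as Listₚ
open import Data.List.Membership.Propositional using (_∈_; lose)
import Data.List.Membership.Propositional.Properties as ∈ₚ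
open import Data.List.Relation.Unary.All as All using (All; []; _∷_)
open import Data.List.Relation.Unary.Any as Any using (Any; here; there)
open import Data.Nat using (ℕ; zero; suc; _+_; _*_; _≤_; _<_; _⊔_; _⊓_; z≤n; s≤s; _≟_; _≤?_)
open import Data.Nat.Properties
open import Data.Product using (∃; ∃₂; _,_; _×_; proj₁; proj₂)
open import Data.Sign as Sign using (Sign)
import Data.Sign.Properties as Signₚ
open import Data.Sum using (inj₁; inj₂; [_,_]′)
open import Data.Vec using (Vec; []; _∷_; lookup; _[_]≔_)
open import Data.Vec.Properties using (lookup∘update; lookup∘update′; []≔-lookup)
open import Function using (_∘_; id)
open import Function.Bundles using (mk⇔)
open import Relation.Nullary using (¬_; Dec; yes; no; does; contradiction)
open import Relation.Nullary.Decidable using (_×-dec_)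
open import Relation.Unary using (Decidable)
open import Relation.Binary.PropositionalEquality

infix 4 _≈[_]_

_≈[_]_ : ℕ → ℕ → ℕ → Set
m ≈[ c ] n = m ⊓ c ≡ n ⊓ c

+-⊓-clamp : ∀ m n c → (m + n) ⊓ c ≡ (m ⊓ c + n ⊓ c) ⊓ c
+-⊓-clamp m n c with ≤-total m c | ≤-total n c
... | inj₁ m≤c | inj₁ n≤c rewrite m≤n⇒m⊓n≡m m≤c | m≤n⇒m⊓n≡m n≤c = refl
... | inj₁ m≤c | inj₂ c≤n rewrite m≤n⇒m⊓n≡m m≤c | m≥n⇒m⊓n≡n c≤n
      | m≥n⇒m⊓n≡n (≤-trans c≤n (m≤n+m n m)) | m≥n⇒m⊓n≡n (m≤n+m c m) = refl
... | inj₂ c≤m | _ rewrite m≥n⇒m⊓n≡n c≤m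
      | m≥n⇒m⊓n≡n (≤-trans c≤m (m≤m+n m n)) | m≥n⇒m⊓n≡n (m≤m+n c (n ⊓ c)) = refl

≈-+ : ∀ {c m m′ n n′} → m ≈[ c ] m′ → n ≈[ c ] n′ → m + n ≈[ c ] m′ + n′
≈-+ {c} {m} {m′} {n} {n′} m≈m′ n≈n′ = begin
  (m + n) ⊓ c             ≡⟨ +-⊓-clamp m n c ⟩
  (m ⊓ c + n ⊓ c) ⊓ c     ≡⟨ cong₂ (λ a b → (a + b) ⊓ c) m≈m′ n≈n′ ⟩
  (m′ ⊓ c + n′ ⊓ c) ⊓ c   ≡⟨ +-⊓-clamp m′ n′ c ⟨
  (m′ + n′) ⊓ c           ∎
  where open ≡-Reasoning

≈-⊔ : ∀ {c m m′ n n′} → m ≈[ c ] m′ → n ≈[ c ] n′ → m ⊔ n ≈[ c ] m′ ⊔ n′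
≈-⊔ {c} {m} {m′} {n} {n′} m≈m′ n≈n′ = begin
  (m ⊔ n) ⊓ c             ≡⟨ ⊓-distribʳ-⊔ c m n ⟩
  (m ⊓ c) ⊔ (n ⊓ c)       ≡⟨ cong₂ _⊔_ m≈m′ n≈n′ ⟩
  (m′ ⊓ c) ⊔ (n′ ⊓ c)     ≡⟨ ⊓-distribʳ-⊔ c m′ n′ ⟨
  (m′ ⊔ n′) ⊓ c           ∎
  where open ≡-Reasoning

≈-weaken : ∀ {c d m n} → c ≤ d → m ≈[ d ] n → m ≈[ c ] n
≈-weaken {c} {d} {m} {n} c≤d m≈n = begin
  m ⊓ c                   ≡⟨ cong (m ⊓_) (m≥n⇒m⊓n≡n c≤d) ⟨
  m ⊓ (d ⊓ c)             ≡⟨ ⊓-assoc m d c ⟨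
  (m ⊓ d) ⊓ c             ≡⟨ cong (_⊓ c) m≈n ⟩
  (n ⊓ d) ⊓ c             ≡⟨ ⊓-assoc n d c ⟩
  n ⊓ (d ⊓ c)             ≡⟨ cong (n ⊓_) (m≥n⇒m⊓n≡n c≤d) ⟩
  n ⊓ c                   ∎
  where open ≡-Reasoning

≈-suc : ∀ {c m n} → m ≈[ c ] n → suc m ≈[ c ] suc n
≈-suc {zero}  {m} {n} _   = trans (⊓-zeroʳ (suc m)) (sym (⊓-zeroʳ (suc n)))
≈-suc {suc c}         m≈n = cong suc (≈-weaken (n≤1+n c) m≈n)

≈-≡-below : ∀ {c m n k} → k < c → m ≈[ c ] n → m ≡ k → n ≡ k
≈-≡-below {c} {n = n} {k} k<c m≈n refl =
  [ (λ n⊓c≡n → trans (sym n⊓c≡n) n⊓c≡k)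
  , (λ n⊓c≡c → contradiction (trans (sym n⊓c≡c) n⊓c≡k) (>⇒≢ k<c))
  ]′ (⊓-sel n c)
  where
  n⊓c≡k : n ⊓ c ≡ k
  n⊓c≡k = trans (sym m≈n) (m≤n⇒m⊓n≡m (<⇒≤ k<c))

≈-≤-below : ∀ {c m n k} → k ≤ c → m ≈[ c ] n → k ≤ m → k ≤ n
≈-≤-below {c} {n = n} {k} k≤c m≈n k≤m =
  ≤-trans (subst (k ≤_) m≈n (⊓-glb k≤m k≤c)) (m⊓n≤m n c)

clamp : (c : ℕ) → ℕ → Fin (suc c)
clamp c n = fromℕ< (s≤s (m⊓n≤n n c))

toℕ-clamp : ∀ c n → toℕ (clamp c n) ≡ n ⊓ c
toℕ-clamp c n = Finₚ.toℕ-fromℕ< (s≤s (m⊓n≤n n c))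

clamp-cong : ∀ {c m n} → m ≈[ c ] n → clamp c m ≡ clamp c n
clamp-cong {c} {m} {n} m≈n =
  Finₚ.toℕ-injective (trans (toℕ-clamp c m) (trans m≈n (sym (toℕ-clamp c n))))

clamp-injective : ∀ {c m n} → clamp c m ≡ clamp c n → m ≈[ c ] n
clamp-injective {c} {m} {n} eq = trans (sym (toℕ-clamp c m)) (trans (cong toℕ eq) (toℕ-clamp c n))

lookup-[]≔-cong : ∀ {A B : Set} (κ : A → B) {n} (xs : Vec A n) i {x y} →
                  κ x ≡ κ y → ∀ j → κ (lookup (xs [ i ]≔ x) j) ≡ κ (lookup (xs [ i ]≔ y) j)
lookup-[]≔-cong κ xs i {x} {y} κx≡κy j with j Fin.≟ i
... | yes refl rewrite lookup∘update i xs x | lookup∘update i xs y = κx≡κy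
... | no j≢i   rewrite lookup∘update′ j≢i xs x | lookup∘update′ j≢i xs y = refl

drop-split : ∀ {A : Set} {i j} (xs : List A) → i < j → j ≤ length xs →
             ∃₂ λ b bs → drop i xs ≡ (b ∷ bs) ++ drop j xs
drop-split {i = zero}  {suc j} (x ∷ xs) _         _         =
  x , take j xs , cong (x ∷_) (sym (Listₚ.take++drop≡id j xs))
drop-split {i = suc i} {suc j} (x ∷ xs) (s≤s i<j) (s≤s j≤n) = drop-split xs i<j j≤n

allVecs : ∀ {A : Set} → List A → (k : ℕ) → List (Vec A k)
allVecs xs zero    = [] ∷ []
allVecs xs (suc k) = List.cartesianProductWith _∷_ xs (allVecs xs k)

∈-allVecs : ∀ {A : Set} {xs : List A} {k} (v : Vec A k) → (∀ j → lookup v j ∈ xs) → v ∈ allVecs xs k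
∈-allVecs []      _   = here refl
∈-allVecs (x ∷ v) v⊆xs = ∈ₚ.∈-cartesianProductWith⁺ _∷_ (v⊆xs zero) (∈-allVecs v (v⊆xs ∘ suc))

countWhere : ∀ {A : Set} {P : A → Set} → Decidable P → List A → ℕ
countWhere P? = length ∘ filter P?

countWhere-++ : ∀ {A : Set} {P : A → Set} (P? : Decidable P) xs ys →
                countWhere P? (xs ++ ys) ≡ countWhere P? xs + countWhere P? ys
countWhere-++ P? xs ys = trans (cong length (Listₚ.filter-++ P? xs ys)) (Listₚ.length-++ (filter P? xs))

countWhere-map : ∀ {A B : Set} {P : B → Set} (P? : Decidable P) (g : A → B) xs →
                 countWhere P? (List.map g xs) ≡ countWhere (P? ∘ g) xs
countWhere-map P? g []       = refl
countWhere-map P? g (x ∷ xs) with does (P? (g x))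
... | true  = cong suc (countWhere-map P? g xs)
... | false = countWhere-map P? g xs

countWhere-by-sign : ∀ {Q : Sign → Set} (Q? : Decidable Q) σs →
  countWhere Q? σs ≡ (if does (Q? Sign.+) then countWhere (Sign._≟ Sign.+) σs else 0)
                   + (if does (Q? Sign.-) then countWhere (Sign._≟ Sign.-) σs else 0)
countWhere-by-sign Q? [] with does (Q? Sign.+) | does (Q? Sign.-)
... | true  | true  = refl
... | true  | false = refl
... | false | true  = refl
... | false | false = refl
countWhere-by-sign Q? (Sign.+ ∷ σs) with does (Q? Sign.+) | countWhere-by-sign Q? σs
... | true  | ih = cong suc ih
... | false | ih = ih
countWhere-by-sign Q? (Sign.- ∷ σs) with does (Q? Sign.-) | countWhere-by-sign Q? σs
... | true  | ih = trans (cong suc ih) (sym (+-suc _ _))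
... | false | ih = ih

countWhere-cong-by-sign : ∀ {c} {Q : Sign → Set} (Q? : Decidable Q) {σs τs} →
  (∀ σ → countWhere (Sign._≟ σ) σs ≈[ c ] countWhere (Sign._≟ σ) τs) →
  countWhere Q? σs ≈[ c ] countWhere Q? τs
countWhere-cong-by-sign Q? {σs} {τs} same
  rewrite countWhere-by-sign Q? σs | countWhere-by-sign Q? τs
  with does (Q? Sign.+) | does (Q? Sign.-)
... | true  | true  = ≈-+ (same Sign.+) (same Sign.-)
... | true  | false = ≈-+ (same Sign.+) refl
... | false | true  = ≈-+ {m = 0} refl (same Sign.-)
... | false | false = refl

v*σ≡τ⇒σ≡v*τ : ∀ v σ τ → v Sign.* σ ≡ τ → σ ≡ v Sign.* τ
v*σ≡τ⇒σ≡v*τ v σ τ refl = begin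
  σ                       ≡⟨ cong (Sign._* σ) (Signₚ.s*s≡+ v) ⟨
  (v Sign.* v) Sign.* σ   ≡⟨ Signₚ.*-assoc v v σ ⟩
  v Sign.* (v Sign.* σ)   ∎
  where open ≡-Reasoning

countWhere-map-* : ∀ v σ σs →
                   countWhere (Sign._≟ σ) (List.map (v Sign.*_) σs) ≡ countWhere (Sign._≟ (v Sign.* σ)) σs
countWhere-map-* v σ []       = refl
countWhere-map-* v σ (τ ∷ σs) with v Sign.* τ Sign.≟ σ | τ Sign.≟ v Sign.* σ
... | yes _  | yes _  = cong suc (countWhere-map-* v σ σs)
... | no _   | no _   = countWhere-map-* v σ σs
... | yes eq | no neq = contradiction (v*σ≡τ⇒σ≡v*τ v τ σ eq) neq
... | no neq | yes eq = contradiction (sym (v*σ≡τ⇒σ≡v*τ v σ τ (sym eq))) neq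

module Shapes (Sg : Signature) where

  mutual
    height : Shape Sg → ℕ
    height cS        = 0
    height (fS f ss) = suc (heightV ss)

    heightV : ∀ {n} → Vec (Shape Sg) n → ℕ
    heightV []       = 0
    heightV (s ∷ ss) = height s ⊔ heightV ss

  mutual
    nodeCount : Shape Sg → ℕ
    nodeCount cS        = 1
    nodeCount (fS f ss) = suc (nodeCountV ss)

    nodeCountV : ∀ {n} → Vec (Shape Sg) n → ℕ
    nodeCountV []       = 0
    nodeCountV (s ∷ ss) = nodeCount s + nodeCountV ss

  heightV-lookup : ∀ {n} (ss : Vec (Shape Sg) n) j → height (lookup ss j) ≤ heightV ss
  heightV-lookup (s ∷ ss) zero    = m≤m⊔n (height s) (heightV ss)
  heightV-lookup (s ∷ ss) (suc j) = ≤-trans (heightV-lookup ss j) (m≤n⊔m (height s) (heightV ss))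

  heightV-attained : ∀ {n} (ss : Vec (Shape Sg) n) → 1 ≤ n → ∃ λ j → heightV ss ≤ height (lookup ss j)
  heightV-attained (s ∷ [])           _ = zero , ≤-reflexive (⊔-identityʳ (height s))
  heightV-attained (s ∷ ss@(_ ∷ _)) _ with ≤-total (height s) (heightV ss) | heightV-attained ss (s≤s z≤n)
  ... | inj₁ hs≤hss | j , hss≤ = suc j , ≤-trans (≤-reflexive (m≤n⇒m⊔n≡n hs≤hss)) hss≤
  ... | inj₂ hss≤hs | _        = zero , ≤-reflexive (m≥n⇒m⊔n≡m hss≤hs)

  heightV-≈ : ∀ {c n} (ss ts : Vec (Shape Sg) n) →
              (∀ j → height (lookup ss j) ≈[ c ] height (lookup ts j)) → heightV ss ≈[ c ] heightV ts
  heightV-≈ []       []       _ = refl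
  heightV-≈ (s ∷ ss) (t ∷ ts) h = ≈-⊔ (h zero) (heightV-≈ ss ts (h ∘ suc))

  height-fS-≈ : ∀ {c} f {ss ts : Vec (Shape Sg) (ar Sg f)} →
                (∀ j → height (lookup ss j) ≈[ c ] height (lookup ts j)) → height (fS f ss) ≈[ c ] height (fS f ts)
  height-fS-≈ {c} f {ss} {ts} same = ≈-suc {c} (heightV-≈ ss ts same)

  nodeCountV-[]≔-< : ∀ {n} (ss : Vec (Shape Sg) n) i {x y} →
                     nodeCount x < nodeCount y → nodeCountV (ss [ i ]≔ x) < nodeCountV (ss [ i ]≔ y)
  nodeCountV-[]≔-< (s ∷ ss) zero    x<y = +-monoˡ-< (nodeCountV ss) x<y
  nodeCountV-[]≔-< (s ∷ ss) (suc i) x<y = +-monoʳ-< (nodeCount s) (nodeCountV-[]≔-< ss i x<y)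

  nodeCountV-lookup : ∀ {n} (ss : Vec (Shape Sg) n) j → nodeCount (lookup ss j) ≤ nodeCountV ss
  nodeCountV-lookup (s ∷ ss) zero    = m≤m+n (nodeCount s) (nodeCountV ss)
  nodeCountV-lookup (s ∷ ss) (suc j) = ≤-trans (nodeCountV-lookup ss j) (m≤n+m (nodeCountV ss) (nodeCount s))

  Frame : Set
  Frame = ∃ λ f → Fin (ar Sg f) × Vec (Shape Sg) (ar Sg f)

  plug₁ : Frame → Shape Sg → Shape Sg
  plug₁ (f , i , ss) x = fS f (ss [ i ]≔ x)

  plug : List Frame → Shape Sg → Shape Sg
  plug Fs x = List.foldr plug₁ x Fs

  plug-++ : ∀ Fs Gs x → plug (Fs ++ Gs) x ≡ plug Fs (plug Gs x)
  plug-++ Fs Gs x = Listₚ.foldr-++ plug₁ x Fs Gs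

  height-plug₁ : ∀ F x → height x < height (plug₁ F x)
  height-plug₁ (f , i , ss) x =
    s≤s (subst (λ y → height y ≤ heightV (ss [ i ]≔ x)) (lookup∘update i ss x)
               (heightV-lookup (ss [ i ]≔ x) i))

  height-plug : ∀ Fs x → height x ≤ height (plug Fs x)
  height-plug []       x = ≤-refl
  height-plug (F ∷ Fs) x = ≤-trans (height-plug Fs x) (<⇒≤ (height-plug₁ F (plug Fs x)))

  height-plug-∷ : ∀ F Fs x → height x < height (plug (F ∷ Fs) x)
  height-plug-∷ F Fs x = ≤-<-trans (height-plug Fs x) (height-plug₁ F (plug Fs x))

  nodeCount-plug₁ : ∀ F x → nodeCount x < nodeCount (plug₁ F x)
  nodeCount-plug₁ (f , i , ss) x =
    s≤s (subst (λ y → nodeCount y ≤ nodeCountV (ss [ i ]≔ x)) (lookup∘update i ss x)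
               (nodeCountV-lookup (ss [ i ]≔ x) i))

  nodeCount-plug : ∀ Fs x → nodeCount x ≤ nodeCount (plug Fs x)
  nodeCount-plug []       x = ≤-refl
  nodeCount-plug (F ∷ Fs) x = ≤-trans (nodeCount-plug Fs x) (<⇒≤ (nodeCount-plug₁ F (plug Fs x)))

  nodeCount-plug-< : ∀ Fs {x y} → nodeCount x < nodeCount y → nodeCount (plug Fs x) < nodeCount (plug Fs y)
  nodeCount-plug-< []                  x<y = x<y
  nodeCount-plug-< ((f , i , ss) ∷ Fs) x<y = s≤s (nodeCountV-[]≔-< ss i (nodeCount-plug-< Fs x<y))

  nodeCount-plug-∷ : ∀ F Fs x → nodeCount x < nodeCount (plug (F ∷ Fs) x)
  nodeCount-plug-∷ F Fs x = ≤-<-trans (nodeCount-plug Fs x) (nodeCount-plug₁ F (plug Fs x))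

  spine : ∀ n s → n ≤ height s → ∃₂ λ Fs w → length Fs ≡ n × plug Fs w ≡ s
  spine zero    s         _         = [] , s , refl , refl
  spine (suc n) (fS f ss) (s≤s n≤h) with heightV-attained ss (ar-pos Sg f)
  ... | j , h≤hj with spine n (lookup ss j) (≤-trans n≤h h≤hj)
  ...   | Fs , w , length≡n , plug≡sj =
    (f , j , ss) ∷ Fs , w , cong suc length≡n ,
    trans (cong (λ x → fS f (ss [ j ]≔ x)) plug≡sj) (cong (fS f) ([]≔-lookup ss j))

  shapesUpTo : ℕ → List (Shape Sg)
  shapesUpTo zero    = cS ∷ []
  shapesUpTo (suc n) =
    cS ∷ List.concatMap (λ f → List.map (fS f) (allVecs (shapesUpTo n) (ar Sg f))) (List.allFin (count Sg))

  ∈-shapesUpTo : ∀ n {s} → height s ≤ n → s ∈ shapesUpTo n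
  ∈-shapesUpTo zero    {cS}      _         = here refl
  ∈-shapesUpTo (suc n) {cS}      _         = here refl
  ∈-shapesUpTo (suc n) {fS f ss} (s≤s h≤n) =
    there (∈ₚ.∈-concat⁺′ (∈ₚ.∈-map⁺ (fS f) (∈-allVecs ss children∈)) (∈ₚ.∈-map⁺ _ (∈ₚ.∈-allFin f)))
    where
    children∈ : ∀ j → lookup ss j ∈ shapesUpTo n
    children∈ j = ∈-shapesUpTo n (≤-trans (heightV-lookup ss j) h≤n)

  maxHeight : List (Shape Sg) → ℕ
  maxHeight = List.foldr (_⊔_ ∘ height) 0

  ∈⇒≤maxHeight : ∀ {s xs} → s ∈ xs → height s ≤ maxHeight xs
  ∈⇒≤maxHeight {xs = x ∷ xs} (here refl) = m≤m⊔n (height x) (maxHeight xs)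
  ∈⇒≤maxHeight {xs = x ∷ xs} (there s∈xs) =
    ≤-trans (∈⇒≤maxHeight s∈xs) (m≤n⊔m (height x) (maxHeight xs))

  Compositional : ∀ {B : Set} → (Shape Sg → B) → Set
  Compositional κ = ∀ f {ss ts : Vec (Shape Sg) (ar Sg f)} →
                    (∀ j → κ (lookup ss j) ≡ κ (lookup ts j)) → κ (fS f ss) ≡ κ (fS f ts)

  module Pumping {M} (κ : Shape Sg → Fin M) (κ-compositional : Compositional κ) where

    κ-plug : ∀ Fs {x y} → κ x ≡ κ y → κ (plug Fs x) ≡ κ (plug Fs y)
    κ-plug []                  κx≡κy = κx≡κy
    κ-plug ((f , i , ss) ∷ Fs) κx≡κy = κ-compositional f (lookup-[]≔-cong κ ss i (κ-plug Fs κx≡κy))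

    record Loop (s : Shape Sg) : Set where
      field
        outer     : List Frame
        loopHead  : Frame
        loopTail  : List Frame
        inner     : Shape Sg

      loop : List Frame
      loop = loopHead ∷ loopTail

      field
        s≡        : s ≡ plug outer (plug loop inner)
        κ-loop    : κ (plug loop inner) ≡ κ inner

    -- The M+1 suffixes of a spine of length M cannot have pairwise distinct κ-values.
    findLoop : ∀ {s} → M ≤ height s → Loop s
    findLoop {s} M≤h with spine M s M≤h
    ... | Fs , w , length≡M , plug≡s
        with Finₚ.pigeonhole (n<1+n M) (λ k → κ (plug (drop (toℕ k) Fs) w))
    ...   | i , j , i<j , κ≡ with drop-split Fs i<j (subst (toℕ j ≤_) (sym length≡M) (Finₚ.toℕ≤pred[n] j))
    ...     | b , bs , drop≡ = record
      { outer = outer ; loopHead = b ; loopTail = bs ; inner = inner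
      ; s≡ = begin
          s                                   ≡⟨ plug≡s ⟨
          plug Fs w                           ≡⟨ cong (λ Gs → plug Gs w) (Listₚ.take++drop≡id (toℕ i) Fs) ⟨
          plug (outer ++ drop (toℕ i) Fs) w   ≡⟨ plug-++ outer _ w ⟩
          plug outer (plug (drop (toℕ i) Fs) w) ≡⟨ cong (plug outer) drop-i ⟩
          plug outer (plug (b ∷ bs) inner)    ∎
      ; κ-loop = trans (cong κ (sym drop-i)) κ≡
      }
      where
      open ≡-Reasoning
      outer = take (toℕ i) Fs
      inner = plug (drop (toℕ j) Fs) w
      drop-i : plug (drop (toℕ i) Fs) w ≡ plug (b ∷ bs) inner
      drop-i = trans (cong (λ Gs → plug Gs w) drop≡) (plug-++ (b ∷ bs) (drop (toℕ j) Fs) w)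

    pump : ∀ {s} → M ≤ height s → ∀ n → ∃ λ s′ → κ s′ ≡ κ s × n ≤ height s′
    pump {s} M≤h n = plug outer (iterate n) , κ-pumped , ≤-trans (height-iterate n) (height-plug outer (iterate n))
      where
      open Loop (findLoop M≤h)

      iterate : ℕ → Shape Sg
      iterate zero    = inner
      iterate (suc n) = plug loop (iterate n)

      κ-iterate : ∀ n → κ (iterate n) ≡ κ inner
      κ-iterate zero    = refl
      κ-iterate (suc n) = trans (κ-plug loop (κ-iterate n)) κ-loop

      height-iterate : ∀ n → n ≤ height (iterate n)
      height-iterate zero    = z≤n
      height-iterate (suc n) = ≤-<-trans (height-iterate n) (height-plug-∷ loopHead loopTail (iterate n))

      κ-pumped : κ (plug outer (iterate n)) ≡ κ s
      κ-pumped = trans (κ-plug outer (trans (κ-iterate n) (sym κ-loop))) (cong κ (sym s≡))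

    cutLoop : ∀ {s} → M ≤ height s → ∃ λ s′ → nodeCount s′ < nodeCount s × κ s′ ≡ κ s
    cutLoop {s} M≤h = plug outer inner ,
                      subst (λ t → nodeCount (plug outer inner) < nodeCount t) (sym s≡)
                        (nodeCount-plug-< outer (nodeCount-plug-∷ loopHead loopTail inner)) ,
                      trans (κ-plug outer (sym κ-loop)) (cong κ (sym s≡))
      where open Loop (findLoop M≤h)

    shrink : ∀ s → ∃ λ s′ → height s′ < M × κ s′ ≡ κ s
    shrink s = go (suc (nodeCount s)) s ≤-refl
      where
      go : ∀ fuel s → nodeCount s < fuel → ∃ λ s′ → height s′ < M × κ s′ ≡ κ s
      go (suc fuel) s (s≤s n≤fuel) with M ≤? height s
      ... | no M≰h  = s , ≰⇒> M≰h , refl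
      ... | yes M≤h with cutLoop M≤h
      ...   | s′ , smaller , κ≡ with go fuel s′ (<-≤-trans smaller n≤fuel)
      ...     | s″ , low , κ≡′ = s″ , low , trans κ≡′ κ≡

module LeafSigns (Sg : Signature) where

  variances : Shape Sg → List Sign
  variances s = List.map (leafVariance {Sg}) (leaves s)

  signCount : Sign → Shape Sg → ℕ
  signCount σ s = countWhere (Sign._≟ σ) (variances s)

  infix 4 _∼[_]_

  _∼[_]_ : Shape Sg → ℕ → Shape Sg → Set
  s ∼[ c ] t = ∀ σ → signCount σ s ≈[ c ] signCount σ t

  variancesV : ∀ f {n} → Vec (Shape Sg) n → (Fin n → Fin (ar Sg f)) → List Sign
  variancesV f ss ι = List.map (leafVariance {Sg}) (leavesV f ss ι)

  countWhere-variancesV-∷ : ∀ σ f {n} s (ss : Vec (Shape Sg) n) ι →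
    countWhere (Sign._≟ σ) (variancesV f (s ∷ ss) ι)
      ≡ signCount (variance Sg f (ι zero) Sign.* σ) s + countWhere (Sign._≟ σ) (variancesV f ss (ι ∘ suc))
  countWhere-variancesV-∷ σ f s ss ι = begin
    #σ (lv (extended ++ leavesV f ss (ι ∘ suc)))   ≡⟨ cong #σ (Listₚ.map-++ (leafVariance {Sg}) extended _) ⟩
    #σ (lv extended ++ rest)                       ≡⟨ countWhere-++ (Sign._≟ σ) (lv extended) rest ⟩
    #σ (lv extended) + #σ rest                     ≡⟨ cong (λ n → #σ n + #σ rest) extended-variances ⟩
    #σ (List.map (v Sign.*_) (variances s)) + #σ rest ≡⟨ cong (_+ #σ rest) (countWhere-map-* v σ (variances s)) ⟩
    signCount (v Sign.* σ) s + #σ rest             ∎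
    where
    open ≡-Reasoning
    #σ = countWhere (Sign._≟ σ)
    lv = List.map (leafVariance {Sg})
    v = variance Sg f (ι zero)
    extended = List.map ((f , ι zero) ∷_) (leaves s)
    rest = variancesV f ss (ι ∘ suc)
    extended-variances : lv extended ≡ List.map (v Sign.*_) (variances s)
    extended-variances = trans (sym (Listₚ.map-∘ (leaves s))) (Listₚ.map-∘ (leaves s))

  variancesV-∼ : ∀ {c} f {n} (ss ts : Vec (Shape Sg) n) ι → (∀ j → lookup ss j ∼[ c ] lookup ts j) → ∀ σ →
                 countWhere (Sign._≟ σ) (variancesV f ss ι) ≈[ c ] countWhere (Sign._≟ σ) (variancesV f ts ι)
  variancesV-∼ f []       []       ι _   σ = refl
  variancesV-∼ f (s ∷ ss) (t ∷ ts) ι ss∼ts σ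
    rewrite countWhere-variancesV-∷ σ f s ss ι | countWhere-variancesV-∷ σ f t ts ι
    = ≈-+ (ss∼ts zero _) (variancesV-∼ f ss ts (ι ∘ suc) (ss∼ts ∘ suc) σ)

  ∼-fS : ∀ {c} f {ss ts : Vec (Shape Sg) (ar Sg f)} →
         (∀ j → lookup ss j ∼[ c ] lookup ts j) → fS f ss ∼[ c ] fS f ts
  ∼-fS {c} f {ss} {ts} = variancesV-∼ {c} f ss ts id

  ∣φ∣-∼ : ∀ {L c} (C : Structure L) φ {s t} → s ∼[ c ] t → ∣ φ ∣[ C ] s ≈[ c ] ∣ φ ∣[ C ] t
  ∣φ∣-∼ {c = c} C φ {s} {t} s∼t
    rewrite sym (countWhere-map (holdsAt? C φ) (leafVariance {Sg}) (leaves s))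
          | sym (countWhere-map (holdsAt? C φ) (leafVariance {Sg}) (leaves t))
    = countWhere-cong-by-sign {c} (holdsAt? C φ) {variances s} {variances t} s∼t

threshold : ∀ {L} → Constraint L → ℕ
threshold (exactly _ k) = k
threshold (atLeast _ k) = k

thresholdBound : ∀ {L} → List (Constraint L) → ℕ
thresholdBound ψ = suc (List.foldr (_⊔_ ∘ threshold) 0 ψ)

threshold<thresholdBound : ∀ {L} (ψ : List (Constraint L)) → All (λ γ → threshold γ < thresholdBound ψ) ψ
threshold<thresholdBound []       = []
threshold<thresholdBound (γ ∷ ψ) =
  s≤s (m≤m⊔n (threshold γ) _) ∷
  All.map (λ k< → ≤-trans k< (s≤s (m≤n⊔m (threshold γ) _))) (threshold<thresholdBound ψ)

module _ {L} (C : Structure L) {Sg : Signature} where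
  open LeafSigns Sg

  HoldsC-∼ : ∀ {c} γ {s t} → threshold γ < c → s ∼[ c ] t → HoldsC C γ s → HoldsC C γ t
  HoldsC-∼ {c} (exactly φ k) {s} {t} k<c s∼t = ≈-≡-below k<c (∣φ∣-∼ {c = c} C φ {s} {t} s∼t)
  HoldsC-∼ {c} (atLeast φ k) {s} {t} k<c s∼t = ≈-≤-below (<⇒≤ k<c) (∣φ∣-∼ {c = c} C φ {s} {t} s∼t)

  HoldsConj-∼ : ∀ {c ψ s t} → All (λ γ → threshold γ < c) ψ →
                s ∼[ c ] t → HoldsConj C ψ s → HoldsConj C ψ t
  HoldsConj-∼ []                 _   []       = []
  HoldsConj-∼ {ψ = γ ∷ _} (b ∷ bs) s∼t (h ∷ hs) = HoldsC-∼ γ b s∼t h ∷ HoldsConj-∼ bs s∼t hs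

  holdsConj? : ∀ ψ (s : Shape Sg) → Dec (HoldsConj C ψ s)
  holdsConj? ψ s = All.all? holdsC? ψ
    where
    holdsC? : ∀ γ → Dec (HoldsC C γ s)
    holdsC? (exactly φ k) = ∣ φ ∣[ C ] s ≟ k
    holdsC? (atLeast φ k) = k ≤? ∣ φ ∣[ C ] s

module Decision {L} (C : Structure L) (Sg : Signature) (ψ : List (Constraint L)) where
  open Shapes Sg
  open LeafSigns Sg

  K : ℕ
  K = thresholdBound ψ

  typeCount : ℕ
  typeCount = suc K * suc K

  clampedCount : Sign → Shape Sg → Fin (suc K)
  clampedCount σ s = clamp K (signCount σ s)

  signType : Shape Sg → Fin typeCount
  signType s = combine (clampedCount Sign.+ s) (clampedCount Sign.- s)

  signType-injective : ∀ s t → signType s ≡ signType t → s ∼[ K ] t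
  signType-injective s t eq Sign.+ = clamp-injective {K} (proj₁ (Finₚ.combine-injective
    (clampedCount Sign.+ s) (clampedCount Sign.- s) (clampedCount Sign.+ t) (clampedCount Sign.- t) eq))
  signType-injective s t eq Sign.- = clamp-injective {K} (proj₂ (Finₚ.combine-injective
    (clampedCount Sign.+ s) (clampedCount Sign.- s) (clampedCount Sign.+ t) (clampedCount Sign.- t) eq))

  signType-compositional : Compositional signType
  signType-compositional f {ss} {ts} same =
    cong₂ combine (clamp-cong {K} (sameSigns Sign.+)) (clamp-cong {K} (sameSigns Sign.-))
    where
    sameSigns : fS f ss ∼[ K ] fS f ts
    sameSigns = ∼-fS f {ss} {ts} λ j → signType-injective (lookup ss j) (lookup ts j) (same j)

  HoldsConj-signType : ∀ s t → signType s ≡ signType t → HoldsConj C ψ s → HoldsConj C ψ t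
  HoldsConj-signType s t eq = HoldsConj-∼ C (threshold<thresholdBound ψ) (signType-injective s t eq)

  profileCount : ℕ
  profileCount = typeCount * suc typeCount

  clampedHeight : Shape Sg → Fin (suc typeCount)
  clampedHeight s = clamp typeCount (height s)

  profile : Shape Sg → Fin profileCount
  profile s = combine (signType s) (clampedHeight s)

  profile-injective : ∀ s t → profile s ≡ profile t → signType s ≡ signType t × height s ≈[ typeCount ] height t
  profile-injective s t eq =
    let type≡ , height≡ = Finₚ.combine-injective (signType s) (clampedHeight s) (signType t) (clampedHeight t) eq
    in type≡ , clamp-injective {typeCount} height≡

  profile-compositional : Compositional profile
  profile-compositional f {ss} {ts} same =
    cong₂ combine (signType-compositional f {ss} {ts} (proj₁ ∘ sameChildren))
                  (clamp-cong {typeCount} (height-fS-≈ f {ss} {ts} (proj₂ ∘ sameChildren)))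
    where
    sameChildren : ∀ j → signType (lookup ss j) ≡ signType (lookup ts j)
                       × height (lookup ss j) ≈[ typeCount ] height (lookup ts j)
    sameChildren j = profile-injective (lookup ss j) (lookup ts j) (same j)

  Tall : Shape Sg → Set
  Tall s = HoldsConj C ψ s × typeCount ≤ height s

  tall? : Decidable Tall
  tall? s = holdsConj? C ψ s ×-dec (typeCount ≤? height s)

  tall⇒unbounded : ∀ {s} → Tall s → ¬ (∃ λ xs → ∀ t → HoldsConj C ψ t → t ∈ xs)
  tall⇒unbounded {s} (holds , tall) (xs , covers) =
    let s′ , type≡ , higher = Pumping.pump signType signType-compositional {s} tall (suc (maxHeight xs))
    in <-irrefl refl (≤-trans higher (∈⇒≤maxHeight (covers s′ (HoldsConj-signType s s′ (sym type≡) holds))))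

  tall⇒tallWitness : ∀ {s} → Tall s → Any Tall (shapesUpTo profileCount)
  tall⇒tallWitness {s} (holds , tall) =
    let s′ , low , profile≡ = Pumping.shrink profile profile-compositional s
        type≡ , height≈     = profile-injective s′ s profile≡
    in lose (∈-shapesUpTo profileCount (<⇒≤ low))
            (HoldsConj-signType s s′ (sym type≡) holds , ≈-≤-below ≤-refl (sym height≈) tall)

  noTallWitness⇒short : ¬ Any Tall (shapesUpTo profileCount) → ∀ {s} → HoldsConj C ψ s → height s < typeCount
  noTallWitness⇒short noTall {s} holds = ≰⇒> λ tall → noTall (tall⇒tallWitness {s} (holds , tall))

mainTheorem5 : (L : Lang) (C : Structure L) (Sg : Signature)
    → (ψ : List (Constraint L))
    → FinitelyComputed {Sg} (λ s → HoldsConj C ψ s)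
mainTheorem5 L C Sg ψ = decide (Any.any? tall? (shapesUpTo profileCount))
  where
  open Shapes Sg
  open Decision C Sg ψ

  decide : Dec (Any Tall (shapesUpTo profileCount)) → FinitelyComputed (HoldsConj C ψ)
  decide (yes someTall) = inj₂ (tall⇒unbounded (proj₂ (Any.satisfied someTall)))
  decide (no noTall)    = inj₁ (filter (holdsConj? C ψ) (shapesUpTo typeCount) , λ s → mk⇔
    (λ holds → ∈ₚ.∈-filter⁺ (holdsConj? C ψ) (∈-shapesUpTo typeCount (<⇒≤ (noTallWitness⇒short noTall holds)))
                            holds)
    (proj₂ ∘ ∈ₚ.∈-filter⁻ (holdsConj? C ψ) {xs = shapesUpTo typeCount}))
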